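{- For any $\nu$HML formula $(X_1,X_1^0,\Delta_1)$ there exists a $\nu$HML formula $(X_2,X_2^0,\Delta_2)$ with $[\![\Delta_1]\!]=[\![\Delta_2]\!]$ such that for every $x\in X_2$, $\Delta_2(x)$ is either $\mathbf{tt}$ or of the form $\bigvee_{i\in I}\big(\bigwedge_{j\in J_i}\langle a_{ij}\rangle x_{ij}\wedge\bigwedge_{a\in\Sigma}[a]y_{i,a}\big)$ for finite (possibly empty) index sets $I$ and $J_i$ ($i\in I$), actions $a_{ij}\in\Sigma$ and variables $x_{ij},y_{i,a}\in X_2$. Additionally, this can be done so that for all $i\in I$, $j\in J_i$, $a\in\Sigma$, if $a_{ij}=a$ then $[\![x_{ij}]\!]\subseteq[\![y_{i,a}]\!]$.
   Context: Fix a finite alphabet $\Sigma$. HML formulae over variables $X$: $\phi::=\mathbf{tt}\mid\mathbf{ff}\mid x\mid\phi\wedge\phi\mid\phi\vee\phi\mid\langle a\rangle\phi\mid[a]\phi$. For an LTS $(I,i^0,\to)$ (image-finite $\to\subseteq I\times\Sigma\times I$) and $\sigma:X\to 2^I$: $[\![\mathbf{tt}]\!]\sigma=I$, $[\![\mathbf{ff}]\!]\sigma=\emptyset$, $[\![x]\!]\sigma=\sigma(x)$, $\wedge/\vee$ as $\cap/\cup$, $[\![\langle a\rangle\phi]\!]\sigma=\{i\mid\exists i\xrightarrow a i', i'\in[\![\phi]\!]\sigma\}$, $[\![[a]\phi]\!]\sigma=\{i\mid\forall i\xrightarrow a i', i'\in[\![\phi]\!]\sigma\}$. For a declaration $\Delta:X\to\mathrm{HML}(X)$,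 $[\![\Delta]\!]$ is the greatest assignment $\sigma$ with $\sigma(x)\subseteq[\![\Delta(x)]\!]\sigma$ for all $x$. A $\nu$HML formula is $(X,X^0,\Delta)$ with $X^0\subseteq X$ finite sets; an LTS implements it iff $i^0\in[\![\Delta]\!](x^0)$ for some $x^0\in X^0$, and $[\![\Delta]\!]$ also denotes the set of implementing LTS. For a variable $x\in X_2$, $[\![x]\!]$ denotes the set of LTS implementing $(X_2,\{x\},\Delta_2)$. -}

module Defs where

open import Level using (Level; 0ℓ) renaming (suc to lsuc)
open import Data.Nat using (ℕ)
open import Data.Fin using (Fin)
open import Data.Fin.Subset using (Subset; _∈_; ⁅_⁆)
open import Data.List using (List; []; _∷_; foldr; map)
open import Data.List.Relation.Unary.Any using (Any)
open import Data.List.Relation.Unary.All using (All)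
open import Data.Vec.Functional renaming (foldr to vfoldr) using ()
open import Data.Unit using (⊤)
open import Data.Empty using (⊥)
open import Data.Product using (Σ; ∃; _×_; _,_)
open import Data.Sum using (_⊎_)

-- The alphabet Σ is Fin k (k fixed, finite).
-- An LTS (I, i⁰, →) with image-finite transition relation, given by
-- its finite lists of a-successors.
record LTS (k : ℕ) : Set₁ where
  field
    State : Set
    init  : State
    step  : State → Fin k → List State
open LTS public

data HML (k m : ℕ) : Set where
  tt ff : HML k m
  var   : Fin m → HML k m
  _∧_ _∨_ : HML k m → HML k m → HML k m
  ⟨_⟩_ [_]_ : Fin k → HML k m → HML k m

⟦_⟧ : ∀ {k m} → HML k m → (L : LTS k) → (Fin m → State L → Set) → State L → Set
⟦ tt ⟧ L σ i = ⊤
⟦ ff ⟧ L σ i = ⊥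
⟦ var x ⟧ L σ i = σ x i
⟦ φ ∧ ψ ⟧ L σ i = ⟦ φ ⟧ L σ i × ⟦ ψ ⟧ L σ i
⟦ φ ∨ ψ ⟧ L σ i = ⟦ φ ⟧ L σ i ⊎ ⟦ ψ ⟧ L σ i
⟦ ⟨ a ⟩ φ ⟧ L σ i = Any (⟦ φ ⟧ L σ) (step L i a)
⟦ [ a ] φ ⟧ L σ i = All (⟦ φ ⟧ L σ) (step L i a)

Decl : ℕ → ℕ → Set
Decl k m = Fin m → HML k m

PostFixed : ∀ {k m} → Decl k m → (L : LTS k) → (Fin m → State L → Set) → Set
PostFixed Δ L σ = ∀ x i → σ x i → ⟦ Δ x ⟧ L σ i

-- ⟦Δ⟧ = greatest assignment σ with σ(x) ⊆ ⟦Δ(x)⟧σ, i.e. the union of all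
-- such post-fixed points (Knaster–Tarski).
⟦_⟧Δ : ∀ {k m} → Decl k m → (L : LTS k) → Fin m → State L → Set₁
⟦ Δ ⟧Δ L x i = Σ (Fin _ → State L → Set) λ σ → PostFixed Δ L σ × σ x i

record νHML (k : ℕ) : Set where
  constructor ⟪_,_,_⟫
  field
    m    : ℕ
    X⁰   : Subset m
    decl : Decl k m

Implements : ∀ {k} → LTS k → νHML k → Set₁
Implements L ⟪ m , X⁰ , Δ ⟫ = Σ (Fin m) λ x⁰ → x⁰ ∈ X⁰ × ⟦ Δ ⟧Δ L x⁰ (init L)

-- ⟦x⟧ for a variable x of Δ: the LTS implementing (X, {x}, Δ)
ImplementsVar : ∀ {k m} → LTS k → Decl k m → Fin m → Set₁
ImplementsVar {m = m} L Δ x = Implements L ⟪ m , ⁅ x ⁆ , Δ ⟫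

-- Normal forms: ⋁_{i∈I} (⋀_{j∈J_i} ⟨a_ij⟩x_ij ∧ ⋀_{a∈Σ} [a]y_{i,a}).
-- A clause is the list of pairs (a_ij, x_ij), j ∈ J_i, and the map a ↦ y_{i,a}.
record Clause (k m : ℕ) : Set where
  constructor clause
  field
    diamonds : List (Fin k × Fin m)
    boxes    : Fin k → Fin m
open Clause public

⋀ : ∀ {k m} → List (HML k m) → HML k m
⋀ = foldr _∧_ tt

⋁ : ∀ {k m} → List (HML k m) → HML k m
⋁ = foldr _∨_ ff

⋀Σ : ∀ {k m} → (Fin k → HML k m) → HML k m
⋀Σ f = vfoldr _∧_ tt f

clauseFormula : ∀ {k m} → Clause k m → HML k m
clauseFormula (clause ds bs) =
  ⋀ (map (λ { (a , x) → ⟨ a ⟩ var x }) ds) ∧ ⋀Σ (λ a → [ a ] var (bs a))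

nfFormula : ∀ {k m} → List (Clause k m) → HML k m
nfFormula cs = ⋁ (map clauseFormula cs)

-- Flattening gives every formula of the closure of Δ (the
-- variables and the subformulae of their bodies) a variable of its own, whose body applies a
-- single connective to variables. On the flat declaration a subset construction follows: a
-- variable of the result is a set U of closure positions, read as "all of U hold", and its body
-- is the disjunction, over all saturated V ⊇ U (closed under the propositional structure of their
-- members), of the clause with a diamond ⟨a⟩({d} ∪ B) for every ⟨a⟩d ∈ V and boxes [a]B, where
-- B = {e | [a]e ∈ V}. A state satisfying all of U saturates U along the true disjuncts, so it
-- satisfies one of these clauses; conversely the clauses unfold back to the truth of U. Since
-- larger sets are satisfied by fewer states and B ⊆ {d} ∪ B, each diamond target implies the
-- corresponding box target.

module Submission where

open import Defs
open import Data.Nat using (ℕ; zero; suc; _^_)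
open import Data.Fin using (Fin; zero; suc; finToFun; funToFin) renaming (_≟_ to _≟ᶠ_)
open import Data.Fin.Properties using (any?; all?; ¬∀⟶∃¬; 2↔Bool; finToFun-funToFin)
open import Data.Fin.Subset using (Subset; _∈_; _∉_; _⊆_; _⊂_; _⊃_; _∪_; ⁅_⁆)
open import Data.Fin.Subset.Properties using (_∈?_; _⊆?_; x∈⁅x⁆; x∈⁅y⁆⇒x≡y; p⊆p∪q; q⊆p∪q; x∈p∪q⁺; x∈p∪q⁻)
open import Data.Fin.Subset.Induction using (Acc; acc; ⊃-wellFounded)
open import Data.List using (List; []; _∷_; _++_; map; concatMap; filter; length; lookup; allFin)
open import Data.List.Membership.Propositional using (find; lose) renaming (_∈_ to _∈ₗ_)
open import Data.List.Membership.Propositional.Properties using (∈-++⁺ˡ; ∈-++⁺ʳ; ∈-++⁻; ∈-concat⁺; ∈-concat⁻; ∈-map⁺; ∈-allFin; ∈-lookup; ∈-filter⁺; ∈-filter⁻)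
open import Data.List.Relation.Unary.Any as Any using (Any; here; there; index)
open import Data.List.Relation.Unary.Any.Properties as Anyₚ using (lookup-index)
open import Data.List.Relation.Unary.All as All using (All; []; _∷_)
open import Data.List.Relation.Unary.All.Properties as Allₚ using ()
open import Data.Vec using (tabulate) renaming (lookup to vlookup)
open import Data.Vec.Properties using (tabulate-cong; tabulate∘lookup; lookup∘tabulate; lookup⇒[]=; []=⇒lookup)
open import Data.Vec.Functional renaming (foldr to vfoldr) using ()
open import Data.Unit using (⊤; tt)
open import Data.Empty using (⊥; ⊥-elim)
open import Data.Product using (Σ; ∃; _×_; _,_; proj₁; proj₂)
open import Data.Sum using (_⊎_; inj₁; inj₂; [_,_]′)
open import Function using (_∘_; id; _⇔_; mk⇔; Equivalence; Inverse)
open import Level using (Level)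
open import Relation.Binary.PropositionalEquality using (_≡_; refl; sym; trans; cong; subst; module ≡-Reasoning)
open import Relation.Nullary using (Dec; yes; no; ¬_; does)
open import Relation.Nullary.Decidable using (_×-dec_; _⊎-dec_; _→-dec_; map′; dec-true)
open import Relation.Unary using (Pred; Decidable)

open Equivalence using (to; from)

private
  variable
    ℓ : Level
    k m n : ℕ

module _ (L : LTS k) (σ : Fin m → State L → Set) (i : State L) where

  ⟦⋀-map⟧ : {A : Set} (f : A → HML k m) (xs : List A) →
    ⟦ ⋀ (map f xs) ⟧ L σ i ⇔ All (λ x → ⟦ f x ⟧ L σ i) xs
  ⟦⋀-map⟧ f [] = mk⇔ (λ _ → []) (λ _ → tt)
  ⟦⋀-map⟧ f (x ∷ xs) =
    mk⇔ (λ (p , ps) → p ∷ to (⟦⋀-map⟧ f xs) ps) (λ { (p ∷ ps) → p , from (⟦⋀-map⟧ f xs) ps })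

  ⟦⋁-map⟧ : {A : Set} (f : A → HML k m) (xs : List A) →
    ⟦ ⋁ (map f xs) ⟧ L σ i ⇔ Any (λ x → ⟦ f x ⟧ L σ i) xs
  ⟦⋁-map⟧ f [] = mk⇔ (λ ()) (λ ())
  ⟦⋁-map⟧ f (x ∷ xs) =
    mk⇔ [ here , there ∘ to (⟦⋁-map⟧ f xs) ]′
        (λ { (here p) → inj₁ p ; (there ps) → inj₂ (from (⟦⋁-map⟧ f xs) ps) })

  ⟦⋀Σ⟧ : ∀ {l} (f : Fin l → HML k m) → ⟦ vfoldr _∧_ tt f ⟧ L σ i ⇔ (∀ a → ⟦ f a ⟧ L σ i)
  ⟦⋀Σ⟧ {zero} f = mk⇔ (λ _ ()) (λ _ → tt)
  ⟦⋀Σ⟧ {suc l} f =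
    mk⇔ (λ { (p , ps) zero → p ; (p , ps) (suc a) → to (⟦⋀Σ⟧ (f ∘ suc)) ps a })
        (λ h → h zero , from (⟦⋀Σ⟧ (f ∘ suc)) (h ∘ suc))

Any-×-All : ∀ {A : Set} {P Q : A → Set} {xs} → Any P xs → All Q xs → Any (λ x → P x × Q x) xs
Any-×-All (here p) (q ∷ _) = here (p , q)
Any-×-All (there ps) (_ ∷ qs) = there (Any-×-All ps qs)

Holds : (L : LTS k) → (Fin m → State L → Set) → State L → Clause k m → Set
Holds L σ i c =
  All (λ (a , x) → Any (σ x) (step L i a)) (diamonds c) × (∀ a → All (σ (boxes c a)) (step L i a))

module _ {L : LTS k} {σ : Fin m → State L → Set} {i : State L} where

  ⟦clause⟧ : (c : Clause k m) → ⟦ clauseFormula c ⟧ L σ i ⇔ Holds L σ i c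
  ⟦clause⟧ (clause ds bs) =
    mk⇔ (λ (p , q) → to (⟦⋀-map⟧ L σ i _ ds) p , to (⟦⋀Σ⟧ L σ i _) q)
        (λ (p , q) → from (⟦⋀-map⟧ L σ i _ ds) p , from (⟦⋀Σ⟧ L σ i _) q)

  ⟦nf⟧ : (cs : List (Clause k m)) → ⟦ nfFormula cs ⟧ L σ i ⇔ Any (Holds L σ i) cs
  ⟦nf⟧ cs = mk⇔ (Any.map (to (⟦clause⟧ _)) ∘ to (⟦⋁-map⟧ L σ i clauseFormula cs))
                (from (⟦⋁-map⟧ L σ i clauseFormula cs) ∘ Any.map (from (⟦clause⟧ _)))

subset : {P : Pred (Fin n) ℓ} → Decidable P → Subset n
subset P? = tabulate (does ∘ P?)

module _ {P : Pred (Fin n) ℓ} (P? : Decidable P) where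

  ∈-subset⁺ : ∀ {c} → P c → c ∈ subset P?
  ∈-subset⁺ {c} p = lookup⇒[]= c _ (trans (lookup∘tabulate _ c) (dec-true (P? c) p))

  ∈-subset⁻ : ∀ {c} → c ∈ subset P? → P c
  ∈-subset⁻ {c} c∈ with P? c | trans (sym (lookup∘tabulate (does ∘ P?) c)) ([]=⇒lookup c∈)
  ... | yes p | _ = p
  ... | no _  | ()

⌞_⌟ : Fin (2 ^ n) → Subset n
⌞ y ⌟ = tabulate (Inverse.to 2↔Bool ∘ finToFun y)

⌜_⌝ : Subset n → Fin (2 ^ n)
⌜ p ⌝ = funToFin (Inverse.from 2↔Bool ∘ vlookup p)

⌞⌜_⌝⌟ : (p : Subset n) → ⌞ ⌜ p ⌝ ⌟ ≡ p
⌞⌜ p ⌝⌟ = begin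
  tabulate (to′ ∘ finToFun (funToFin (from′ ∘ vlookup p)))
    ≡⟨ tabulate-cong (cong to′ ∘ finToFun-funToFin (from′ ∘ vlookup p)) ⟩
  tabulate (to′ ∘ from′ ∘ vlookup p)
    ≡⟨ tabulate-cong (Inverse.strictlyInverseˡ 2↔Bool ∘ vlookup p) ⟩
  tabulate (vlookup p)
    ≡⟨ tabulate∘lookup p ⟩
  p ∎
  where
  open ≡-Reasoning
  to′ = Inverse.to 2↔Bool
  from′ = Inverse.from 2↔Bool

∈⌞⌜⌝⌟⁺ : ∀ {p : Subset n} {c} → c ∈ p → c ∈ ⌞ ⌜ p ⌝ ⌟
∈⌞⌜⌝⌟⁺ {p = p} = subst (_ ∈_) (sym ⌞⌜ p ⌝⌟)

∈⌞⌜⌝⌟⁻ : ∀ {p : Subset n} {c} → c ∈ ⌞ ⌜ p ⌝ ⌟ → c ∈ p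
∈⌞⌜⌝⌟⁻ {p = p} = subst (_ ∈_) ⌞⌜ p ⌝⌟

allSubsets : ∀ n → List (Subset n)
allSubsets n = map ⌞_⌟ (allFin (2 ^ n))

∈-allSubsets : (p : Subset n) → p ∈ₗ allSubsets n
∈-allSubsets p = subst (_∈ₗ _) ⌞⌜ p ⌝⌟ (∈-map⁺ ⌞_⌟ (∈-allFin ⌜ p ⌝))

module Saturation (Local : Subset n → Fin n → Set) (local? : ∀ U → Decidable (Local U)) where

  Saturated : Subset n → Set
  Saturated U = ∀ {c} → c ∈ U → Local U c

  defect : ∀ U → ¬ Saturated U → ∃ λ c → c ∈ U × ¬ Local U c
  defect U ¬sat with ¬∀⟶∃¬ n _ (λ c → c ∈? U →-dec local? U c) (λ sat → ¬sat (sat _))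
  ... | c , ¬ok with c ∈? U
  ...   | yes c∈U = c , c∈U , ¬ok ∘ (λ l _ → l)
  ...   | no c∉U = ⊥-elim (¬ok (⊥-elim ∘ c∉U))

  saturated? : ∀ U → Dec (Saturated U)
  saturated? U = map′ (λ sat {c} → sat c) (λ sat c → sat) (all? (λ c → c ∈? U →-dec local? U c))

  module _ (Good : Fin n → Set)
    (repair : ∀ {U c} → c ∈ U → (∀ {d} → d ∈ U → Good d) → ¬ Local U c → ∃ λ d → d ∉ U × Good d)
    where

    AllGood : Subset n → Set
    AllGood U = ∀ {c} → c ∈ U → Good c

    extend : ∀ U → Acc _⊃_ U → AllGood U → ∃ λ V → U ⊆ V × Saturated V × AllGood V
    extend U (acc larger) good with saturated? U
    ... | yes sat = U , id , sat , good
    ... | no ¬sat with defect U ¬sat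
    ...   | c , c∈U , ¬local with repair c∈U good ¬local
    ...     | d , d∉U , good-d with extend (U ∪ ⁅ d ⁆) (larger U⊂U∪d) good′
      where
      U⊂U∪d : U ⊂ U ∪ ⁅ d ⁆
      U⊂U∪d = p⊆p∪q ⁅ d ⁆ , d , q⊆p∪q U ⁅ d ⁆ (x∈⁅x⁆ d) , d∉U
      good′ : AllGood (U ∪ ⁅ d ⁆)
      good′ e∈ with x∈p∪q⁻ U ⁅ d ⁆ e∈
      ... | inj₁ e∈U = good e∈U
      ... | inj₂ e∈d = subst Good (sym (x∈⁅y⁆⇒x≡y d e∈d)) good-d
    ... | V , U∪d⊆V , sat , goodV = V , U∪d⊆V ∘ p⊆p∪q ⁅ d ⁆ , sat , goodV

    saturate : ∀ T → AllGood T → ∃ λ U → T ⊆ U × Saturated U × AllGood U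
    saturate T = extend T (⊃-wellFounded T)

data Flat (k n : ℕ) : Set where
  tt ff : Flat k n
  var : Fin n → Flat k n
  _∧_ _∨_ : Fin n → Fin n → Flat k n
  ⟨_⟩_ [_]_ : Fin k → Fin n → Flat k n

embed : Flat k n → HML k n
embed tt = tt
embed ff = ff
embed (var c) = var c
embed (c ∧ d) = var c ∧ var d
embed (c ∨ d) = var c ∨ var d
embed (⟨ a ⟩ c) = ⟨ a ⟩ var c
embed ([ a ] c) = [ a ] var c

infix 4 _≺_
data _≺_ {k m} : HML k m → HML k m → Set where
  ∧ˡ : ∀ {φ ψ} → φ ≺ φ ∧ ψ
  ∧ʳ : ∀ {φ ψ} → ψ ≺ φ ∧ ψ
  ∨ˡ : ∀ {φ ψ} → φ ≺ φ ∨ ψ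
  ∨ʳ : ∀ {φ ψ} → ψ ≺ φ ∨ ψ
  ⟨⟩ : ∀ {a φ} → φ ≺ ⟨ a ⟩ φ
  [] : ∀ {a φ} → φ ≺ [ a ] φ

subformulas properSubformulas : HML k m → List (HML k m)
subformulas φ = φ ∷ properSubformulas φ
properSubformulas tt = []
properSubformulas ff = []
properSubformulas (var x) = []
properSubformulas (φ ∧ ψ) = subformulas φ ++ subformulas ψ
properSubformulas (φ ∨ ψ) = subformulas φ ++ subformulas ψ
properSubformulas (⟨ a ⟩ φ) = subformulas φ
properSubformulas ([ a ] φ) = subformulas φ

≺⇒∈properSubformulas : ∀ {φ ψ : HML k m} → ψ ≺ φ → ψ ∈ₗ properSubformulas φ
≺⇒∈properSubformulas ∧ˡ = here refl
≺⇒∈properSubformulas (∧ʳ {φ}) = ∈-++⁺ʳ (subformulas φ) (here refl)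
≺⇒∈properSubformulas ∨ˡ = here refl
≺⇒∈properSubformulas (∨ʳ {φ}) = ∈-++⁺ʳ (subformulas φ) (here refl)
≺⇒∈properSubformulas ⟨⟩ = here refl
≺⇒∈properSubformulas [] = here refl

subformulas-closed : ∀ {φ ψ : HML k m} χ → ψ ≺ φ → φ ∈ₗ subformulas χ → ψ ∈ₗ subformulas χ
subformulas-closed-++ : ∀ {φ ψ : HML k m} χ χ′ → ψ ≺ φ →
  φ ∈ₗ subformulas χ ++ subformulas χ′ → ψ ∈ₗ subformulas χ ++ subformulas χ′
subformulas-closed χ ψ≺φ (here refl) = there (≺⇒∈properSubformulas ψ≺φ)
subformulas-closed (χ ∧ χ′) ψ≺φ (there φ∈) = there (subformulas-closed-++ χ χ′ ψ≺φ φ∈)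
subformulas-closed (χ ∨ χ′) ψ≺φ (there φ∈) = there (subformulas-closed-++ χ χ′ ψ≺φ φ∈)
subformulas-closed (⟨ a ⟩ χ) ψ≺φ (there φ∈) = there (subformulas-closed χ ψ≺φ φ∈)
subformulas-closed ([ a ] χ) ψ≺φ (there φ∈) = there (subformulas-closed χ ψ≺φ φ∈)
subformulas-closed-++ χ χ′ ψ≺φ φ∈ =
  [ ∈-++⁺ˡ ∘ subformulas-closed χ ψ≺φ , ∈-++⁺ʳ (subformulas χ) ∘ subformulas-closed χ′ ψ≺φ ]′
    (∈-++⁻ (subformulas χ) φ∈)

module Flattening (Δ : Decl k m) where

  closure : List (HML k m)
  closure = concatMap (λ x → var x ∷ subformulas (Δ x)) (allFin m)

  ∈-closure : ∀ {φ} x → φ ∈ₗ var x ∷ subformulas (Δ x) → φ ∈ₗ closure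
  ∈-closure x φ∈ = ∈-concat⁺ (Anyₚ.map⁺ (Anyₚ.tabulate⁺ x φ∈))

  closure-closed : ∀ {φ ψ} → ψ ≺ φ → φ ∈ₗ closure → ψ ∈ₗ closure
  closure-closed ψ≺φ φ∈
    with Anyₚ.tabulate⁻ {f = id} (Anyₚ.map⁻ {f = λ x → var x ∷ subformulas (Δ x)} (∈-concat⁻ _ φ∈))
  ... | x , there φ∈Δx = ∈-closure x (there (subformulas-closed (Δ x) ψ≺φ φ∈Δx))
  ... | x , here refl with ψ≺φ
  ...   | ()

  ∣closure∣ : ℕ
  ∣closure∣ = length closure

  form : Fin ∣closure∣ → HML k m
  form = lookup closure

  position : ∀ {φ} → φ ∈ₗ closure → Fin ∣closure∣
  position = index

  form-position : ∀ {φ} (φ∈ : φ ∈ₗ closure) → form (position φ∈) ≡ φ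
  form-position φ∈ = sym (lookup-index φ∈)

  child : ∀ {φ ψ} → ψ ≺ φ → φ ∈ₗ closure → Fin ∣closure∣
  child ψ≺φ = position ∘ closure-closed ψ≺φ

  form-child : ∀ {φ ψ} (ψ≺φ : ψ ≺ φ) (φ∈ : φ ∈ₗ closure) → form (child ψ≺φ φ∈) ≡ ψ
  form-child ψ≺φ = form-position ∘ closure-closed ψ≺φ

  ι : Fin m → Fin ∣closure∣
  ι x = position (∈-closure x (here refl))

  body : Fin m → Fin ∣closure∣
  body x = position (∈-closure x (there (here refl)))

  -- φ ▷ ν: ν is φ with its immediate subformulae replaced by closure positions holding them,
  -- where a variable x is replaced by a position holding its body Δ x.
  infix 4 _▷_
  data _▷_ : HML k m → Flat k ∣closure∣ → Set where
    ▷-tt : tt ▷ tt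
    ▷-ff : ff ▷ ff
    ▷-var : ∀ {x c} → form c ≡ Δ x → var x ▷ var c
    ▷-∧ : ∀ {φ ψ c d} → form c ≡ φ → form d ≡ ψ → φ ∧ ψ ▷ c ∧ d
    ▷-∨ : ∀ {φ ψ c d} → form c ≡ φ → form d ≡ ψ → φ ∨ ψ ▷ c ∨ d
    ▷-⟨⟩ : ∀ {a φ c} → form c ≡ φ → ⟨ a ⟩ φ ▷ ⟨ a ⟩ c
    ▷-[] : ∀ {a φ c} → form c ≡ φ → [ a ] φ ▷ [ a ] c

  flatten : ∀ φ → φ ∈ₗ closure → ∃ (φ ▷_)
  flatten tt _ = tt , ▷-tt
  flatten ff _ = ff , ▷-ff
  flatten (var x) _ = var (body x) , ▷-var (form-position _)
  flatten (φ ∧ ψ) p = child ∧ˡ p ∧ child ∧ʳ p , ▷-∧ (form-child ∧ˡ p) (form-child ∧ʳ p)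
  flatten (φ ∨ ψ) p = child ∨ˡ p ∨ child ∨ʳ p , ▷-∨ (form-child ∨ˡ p) (form-child ∨ʳ p)
  flatten (⟨ a ⟩ φ) p = ⟨ a ⟩ child ⟨⟩ p , ▷-⟨⟩ (form-child ⟨⟩ p)
  flatten ([ a ] φ) p = [ a ] child [] p , ▷-[] (form-child [] p)

  Δᶠ : Fin ∣closure∣ → Flat k ∣closure∣
  Δᶠ c = proj₁ (flatten (form c) (∈-lookup c))

  form▷Δᶠ : ∀ c → form c ▷ Δᶠ c
  form▷Δᶠ c = proj₂ (flatten (form c) (∈-lookup c))

  module FromΔ (L : LTS k) (σ : Fin m → State L → Set) (post : PostFixed Δ L σ) where

    σᶠ : Fin ∣closure∣ → State L → Set
    σᶠ c i = ⟦ form c ⟧ L σ i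

    at : ∀ {c φ i} → form c ≡ φ → ⟦ φ ⟧ L σ i → σᶠ c i
    at eq = subst (λ φ → ⟦ φ ⟧ L σ _) (sym eq)

    ▷-sound : ∀ {φ ν i} → φ ▷ ν → ⟦ φ ⟧ L σ i → ⟦ embed ν ⟧ L σᶠ i
    ▷-sound ▷-tt s = s
    ▷-sound ▷-ff s = s
    ▷-sound (▷-var eq) s = at eq (post _ _ s)
    ▷-sound (▷-∧ eq eq′) (s , s′) = at eq s , at eq′ s′
    ▷-sound (▷-∨ eq eq′) (inj₁ s) = inj₁ (at eq s)
    ▷-sound (▷-∨ eq eq′) (inj₂ s′) = inj₂ (at eq′ s′)
    ▷-sound (▷-⟨⟩ eq) s = Any.map (at eq) s
    ▷-sound (▷-[] eq) s = All.map (at eq) s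

    post-σᶠ : PostFixed (embed ∘ Δᶠ) L σᶠ
    post-σᶠ c i = ▷-sound (form▷Δᶠ c)

  module ToΔ (L : LTS k) (σᶠ : Fin ∣closure∣ → State L → Set) (postᶠ : PostFixed (embed ∘ Δᶠ) L σᶠ)
    where

    -- The closure may list Δ x at several positions.
    σ : Fin m → State L → Set
    σ x i = ∃ λ c → form c ≡ Δ x × σᶠ c i

    truth : ∀ φ {c i} → form c ≡ φ → σᶠ c i → ⟦ φ ⟧ L σ i
    truth-▷ : ∀ φ {ν i} → φ ▷ ν → ⟦ embed ν ⟧ L σᶠ i → ⟦ φ ⟧ L σ i
    truth φ {c} eq s = truth-▷ φ (subst (_▷ Δᶠ c) eq (form▷Δᶠ c)) (postᶠ c _ s)
    truth-▷ tt ▷-tt s = s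
    truth-▷ ff ▷-ff s = s
    truth-▷ (var x) (▷-var eq) s = _ , eq , s
    truth-▷ (φ ∧ ψ) (▷-∧ eq eq′) (s , s′) = truth φ eq s , truth ψ eq′ s′
    truth-▷ (φ ∨ ψ) (▷-∨ eq eq′) (inj₁ s) = inj₁ (truth φ eq s)
    truth-▷ (φ ∨ ψ) (▷-∨ eq eq′) (inj₂ s′) = inj₂ (truth ψ eq′ s′)
    truth-▷ (⟨ a ⟩ φ) (▷-⟨⟩ eq) s = Any.map (truth φ eq) s
    truth-▷ ([ a ] φ) (▷-[] eq) s = All.map (truth φ eq) s

    post-σ : PostFixed Δ L σ
    post-σ x i (c , eq , s) = truth (Δ x) eq s

  ⟦Δ⟧⇒⟦Δᶠ⟧ : ∀ {L : LTS k} {x i} → ⟦ Δ ⟧Δ L x i → ⟦ embed ∘ Δᶠ ⟧Δ L (ι x) i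
  ⟦Δ⟧⇒⟦Δᶠ⟧ {L} (σ , post , s) = σᶠ , post-σᶠ , at (form-position _) s
    where open FromΔ L σ post

  ⟦Δᶠ⟧⇒⟦Δ⟧ : ∀ {L : LTS k} {x i} → ⟦ embed ∘ Δᶠ ⟧Δ L (ι x) i → ⟦ Δ ⟧Δ L x i
  ⟦Δᶠ⟧⇒⟦Δ⟧ {L} (σᶠ , postᶠ , s) = σ , post-σ , truth (var _) (form-position _) s
    where open ToΔ L σᶠ postᶠ

module SubsetConstruction (Δᶠ : Fin n → Flat k n) where

  -- Modal formulae impose no local condition: the clause of U discharges them.
  Local : Subset n → Flat k n → Set
  Local U tt = ⊤
  Local U ff = ⊥
  Local U (var c) = c ∈ U
  Local U (c ∧ d) = c ∈ U × d ∈ U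
  Local U (c ∨ d) = c ∈ U ⊎ d ∈ U
  Local U (⟨ a ⟩ c) = ⊤
  Local U ([ a ] c) = ⊤

  local? : ∀ U φ → Dec (Local U φ)
  local? U tt = yes tt
  local? U ff = no id
  local? U (var c) = c ∈? U
  local? U (c ∧ d) = c ∈? U ×-dec d ∈? U
  local? U (c ∨ d) = c ∈? U ⊎-dec d ∈? U
  local? U (⟨ a ⟩ c) = yes tt
  local? U ([ a ] c) = yes tt

  open Saturation (λ U → Local U ∘ Δᶠ) (λ U → local? U ∘ Δᶠ)

  Extends : Subset n → Subset n → Set
  Extends T U = T ⊆ U × Saturated U

  extends? : ∀ T U → Dec (Extends T U)
  extends? T U = T ⊆? U ×-dec saturated? U

  is-box? : ∀ a d (φ : Flat k n) → Dec (φ ≡ [ a ] d)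
  is-box? a d ([ b ] e) with b ≟ᶠ a | e ≟ᶠ d
  ... | yes refl | yes refl = yes refl
  ... | no b≢a | _ = no λ { refl → b≢a refl }
  ... | yes _ | no e≢d = no λ { refl → e≢d refl }
  is-box? a d tt = no λ ()
  is-box? a d ff = no λ ()
  is-box? a d (var _) = no λ ()
  is-box? a d (_ ∧ _) = no λ ()
  is-box? a d (_ ∨ _) = no λ ()
  is-box? a d (⟨ _ ⟩ _) = no λ ()

  Boxed : Fin k → Subset n → Fin n → Set
  Boxed a U d = ∃ λ c → c ∈ U × Δᶠ c ≡ [ a ] d

  boxed? : ∀ a U → Decidable (Boxed a U)
  boxed? a U d = any? (λ c → c ∈? U ×-dec is-box? a d (Δᶠ c))

  boxed : Fin k → Subset n → Subset n
  boxed a U = subset (boxed? a U)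

  after : Fin k → Fin n → Subset n → Subset n
  after a d U = ⁅ d ⁆ ∪ boxed a U

  diamondsAt : Subset n → Flat k n → List (Fin k × Fin (2 ^ n))
  diamondsAt U (⟨ a ⟩ d) = (a , ⌜ after a d U ⌝) ∷ []
  diamondsAt U _ = []

  clauseOf : Subset n → Clause k (2 ^ n)
  clauseOf U =
    clause (concatMap (diamondsAt U ∘ Δᶠ) (filter (_∈? U) (allFin n))) (λ a → ⌜ boxed a U ⌝)

  Δ₂ : Decl k (2 ^ n)
  Δ₂ y = nfFormula (map clauseOf (filter (extends? ⌞ y ⌟) (allSubsets n)))

  ∈-boxed⁺ : ∀ {a U c d} → c ∈ U → Δᶠ c ≡ [ a ] d → d ∈ boxed a U
  ∈-boxed⁺ {a} {U} c∈U eq = ∈-subset⁺ (boxed? a U) (_ , c∈U , eq)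

  ∈-boxed⁻ : ∀ {a U d} → d ∈ boxed a U → Boxed a U d
  ∈-boxed⁻ {a} {U} = ∈-subset⁻ (boxed? a U)

  boxed⊆after : ∀ {a d U} → ⌞ ⌜ boxed a U ⌝ ⌟ ⊆ ⌞ ⌜ after a d U ⌝ ⌟
  boxed⊆after {a} {d} {U} = ∈⌞⌜⌝⌟⁺ ∘ q⊆p∪q ⁅ d ⁆ (boxed a U) ∘ ∈⌞⌜⌝⌟⁻

  module _ {Q : Fin k × Fin (2 ^ n) → Set ℓ} (U : Subset n) where

    all-diamonds⁺ : (∀ {c a d} → c ∈ U → Δᶠ c ≡ ⟨ a ⟩ d → Q (a , ⌜ after a d U ⌝)) →
                    All Q (diamonds (clauseOf U))
    all-diamonds⁺ h = Allₚ.concat⁺ (Allₚ.map⁺ {f = diamondsAt U ∘ Δᶠ}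
      (All.tabulate (λ {c} c∈ → at (Δᶠ c) (h (proj₂ (∈-filter⁻ (_∈? U) {xs = allFin n} c∈))))))
      where
      at : ∀ φ → (∀ {a d} → φ ≡ ⟨ a ⟩ d → Q (a , ⌜ after a d U ⌝)) → All Q (diamondsAt U φ)
      at tt _ = []
      at ff _ = []
      at (var _) _ = []
      at (_ ∧ _) _ = []
      at (_ ∨ _) _ = []
      at (⟨ a ⟩ d) h = h refl ∷ []
      at ([ _ ] _) _ = []

    all-diamonds⁻ : All Q (diamonds (clauseOf U)) →
                    ∀ {c a d} → c ∈ U → Δᶠ c ≡ ⟨ a ⟩ d → Q (a , ⌜ after a d U ⌝)
    all-diamonds⁻ qs {c} c∈U eq =
      All.head (subst (All Q ∘ diamondsAt U) eq
        (All.lookup (Allₚ.map⁻ (Allₚ.concat⁻ qs)) (∈-filter⁺ (_∈? U) (∈-allFin c) c∈U)))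

  ⟦Δ₂⟧ : ∀ {L : LTS k} {σ i y} → ⟦ Δ₂ y ⟧ L σ i ⇔ ∃ λ U → Extends ⌞ y ⌟ U × Holds L σ i (clauseOf U)
  ⟦Δ₂⟧ {L = L} {σ} {i} {y} = mk⇔
    (λ s → let U , U∈ , h = find (Anyₚ.map⁻ (to (⟦nf⟧ candidates) s))
           in U , proj₂ (∈-filter⁻ (extends? ⌞ y ⌟) {xs = allSubsets n} U∈) , h)
    (λ (U , ext , h) → from (⟦nf⟧ candidates)
      (Anyₚ.map⁺ (lose {P = Holds L σ i ∘ clauseOf}
        (∈-filter⁺ (extends? ⌞ y ⌟) (∈-allSubsets U) ext) h)))
    where
    candidates = map clauseOf (filter (extends? ⌞ y ⌟) (allSubsets n))

  module ToΔᶠ (L : LTS k) (σ₂ : Fin (2 ^ n) → State L → Set) (post₂ : PostFixed Δ₂ L σ₂) where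

    Witnessed : Fin n → State L → Set
    Witnessed c i = ∃ λ U → Saturated U × c ∈ U × Holds L σ₂ i (clauseOf U)

    witnessed : ∀ {y i c} → σ₂ y i → c ∈ ⌞ y ⌟ → Witnessed c i
    witnessed s c∈y with to ⟦Δ₂⟧ (post₂ _ _ s)
    ... | U , (y⊆U , sat) , h = U , sat , y⊆U c∈y , h

    post-witnessed : PostFixed (embed ∘ Δᶠ) L Witnessed
    post-witnessed c i (U , sat , c∈U , h@(dias , boxes)) = unfold (Δᶠ c) refl (sat c∈U)
      where
      unfold : ∀ φ → Δᶠ c ≡ φ → Local U φ → ⟦ embed φ ⟧ L Witnessed i
      unfold tt _ _ = tt
      unfold (var d) _ d∈U = U , sat , d∈U , h
      unfold (d ∧ e) _ (d∈U , e∈U) = (U , sat , d∈U , h) , (U , sat , e∈U , h)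
      unfold (d ∨ e) _ (inj₁ d∈U) = inj₁ (U , sat , d∈U , h)
      unfold (d ∨ e) _ (inj₂ e∈U) = inj₂ (U , sat , e∈U , h)
      unfold (⟨ a ⟩ d) eq _ =
        Any.map (λ s → witnessed s (∈⌞⌜⌝⌟⁺ (x∈p∪q⁺ (inj₁ (x∈⁅x⁆ d))))) (all-diamonds⁻ U dias c∈U eq)
      unfold ([ a ] d) eq _ = All.map (λ s → witnessed s (∈⌞⌜⌝⌟⁺ (∈-boxed⁺ c∈U eq))) (boxes a)

  module FromΔᶠ (L : LTS k) (σ : Fin n → State L → Set) (post : PostFixed (embed ∘ Δᶠ) L σ) where

    AllHold : State L → Subset n → Set
    AllHold i U = ∀ {c} → c ∈ U → σ c i

    σ₂ : Fin (2 ^ n) → State L → Set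
    σ₂ y i = AllHold i ⌞ y ⌟

    repair : ∀ {i U c} → c ∈ U → AllHold i U → ¬ Local U (Δᶠ c) → ∃ λ d → d ∉ U × σ d i
    repair {i} {U} {c} c∈U hold = fix (Δᶠ c) (post c i (hold c∈U))
      where
      fix : ∀ φ → ⟦ embed φ ⟧ L σ i → ¬ Local U φ → ∃ λ d → d ∉ U × σ d i
      fix tt _ ¬local = ⊥-elim (¬local tt)
      fix ff () _
      fix (var d) s ¬local = d , ¬local , s
      fix (d ∧ e) (s , s′) ¬local with d ∈? U
      ... | yes d∈U = e , (λ e∈U → ¬local (d∈U , e∈U)) , s′
      ... | no d∉U = d , d∉U , s
      fix (d ∨ e) (inj₁ s) ¬local = d , ¬local ∘ inj₁ , s
      fix (d ∨ e) (inj₂ s′) ¬local = e , ¬local ∘ inj₂ , s′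
      fix (⟨ a ⟩ d) _ ¬local = ⊥-elim (¬local tt)
      fix ([ a ] d) _ ¬local = ⊥-elim (¬local tt)

    boxes-hold : ∀ {i U} → AllHold i U → ∀ a → All (λ i′ → AllHold i′ (boxed a U)) (step L i a)
    boxes-hold {i} hold a = All.tabulate λ i′∈ d∈ →
      let c , c∈U , eq = ∈-boxed⁻ d∈ in
      All.lookup (subst (λ φ → ⟦ embed φ ⟧ L σ i) eq (post c i (hold c∈U))) i′∈

    clause-holds : ∀ {i U} → AllHold i U → Holds L σ₂ i (clauseOf U)
    clause-holds {i} {U} hold =
      all-diamonds⁺ U diamond , λ a → All.map (λ hold′ {_} e∈ → hold′ (∈⌞⌜⌝⌟⁻ e∈)) (boxes-hold hold a)
      where
      diamond : ∀ {c a d} → c ∈ U → Δᶠ c ≡ ⟨ a ⟩ d → Any (σ₂ ⌜ after a d U ⌝) (step L i a)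
      diamond {c} {a} {d} c∈U eq =
        Any.map (λ (s , hold′) {_} e∈ → merge s hold′ (∈⌞⌜⌝⌟⁻ e∈))
          (Any-×-All {Q = λ i′ → AllHold i′ (boxed a U)}
            (subst (λ φ → ⟦ embed φ ⟧ L σ i) eq (post c i (hold c∈U))) (boxes-hold hold a))
        where
        merge : ∀ {i′} → σ d i′ → AllHold i′ (boxed a U) → AllHold i′ (after a d U)
        merge s hold′ e∈ with x∈p∪q⁻ ⁅ d ⁆ (boxed a U) e∈
        ... | inj₁ e∈d = subst (λ e → σ e _) (sym (x∈⁅y⁆⇒x≡y d e∈d)) s
        ... | inj₂ e∈boxed = hold′ e∈boxed

    post-σ₂ : PostFixed Δ₂ L σ₂
    post-σ₂ y i hold with saturate (λ d → σ d i) repair ⌞ y ⌟ hold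
    ... | U , y⊆U , sat , holdU = from ⟦Δ₂⟧ (U , (y⊆U , sat) , clause-holds holdU)

  ⟦Δ₂⟧⇒⟦Δᶠ⟧ : ∀ {L : LTS k} {y i c} → ⟦ Δ₂ ⟧Δ L y i → c ∈ ⌞ y ⌟ → ⟦ embed ∘ Δᶠ ⟧Δ L c i
  ⟦Δ₂⟧⇒⟦Δᶠ⟧ {L} (σ₂ , post₂ , s) c∈y = Witnessed , post-witnessed , witnessed s c∈y
    where open ToΔᶠ L σ₂ post₂

  ⟦Δᶠ⟧⇒⟦Δ₂⟧ : ∀ {L : LTS k} {c i} → ⟦ embed ∘ Δᶠ ⟧Δ L c i → ⟦ Δ₂ ⟧Δ L ⌜ ⁅ c ⁆ ⌝ i
  ⟦Δᶠ⟧⇒⟦Δ₂⟧ {L} {c} (σ , post , s) =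
    σ₂ , post-σ₂ , λ d∈ → subst (λ d → σ d _) (sym (x∈⁅y⁆⇒x≡y c (∈⌞⌜⌝⌟⁻ d∈))) s
    where open FromΔᶠ L σ post

  ⟦Δ₂⟧-antitone : ∀ {L : LTS k} {y y′ i} → ⌞ y′ ⌟ ⊆ ⌞ y ⌟ → ⟦ Δ₂ ⟧Δ L y i → ⟦ Δ₂ ⟧Δ L y′ i
  ⟦Δ₂⟧-antitone {L} y′⊆y (σ₂ , post₂ , s) = σ₂′ , post-σ₂′ , witnessed s ∘ y′⊆y
    where
    open ToΔᶠ L σ₂ post₂
    open FromΔᶠ L Witnessed post-witnessed renaming (σ₂ to σ₂′; post-σ₂ to post-σ₂′)

  ImplementsVar-antitone : ∀ {L y y′} → ⌞ y′ ⌟ ⊆ ⌞ y ⌟ →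
                           ImplementsVar L Δ₂ y → ImplementsVar L Δ₂ y′
  ImplementsVar-antitone {y = y} {y′} y′⊆y (z , z∈y , s) with x∈⁅y⁆⇒x≡y y z∈y
  ... | refl = y′ , x∈⁅x⁆ y′ , ⟦Δ₂⟧-antitone y′⊆y s

  diamond⇒box : ∀ U → All (λ (a , y) → (L : LTS k) →
                                ImplementsVar L Δ₂ y → ImplementsVar L Δ₂ (boxes (clauseOf U) a))
                             (diamonds (clauseOf U))
  diamond⇒box U =
    all-diamonds⁺ U (λ {_} {a} {d} _ _ L → ImplementsVar-antitone (boxed⊆after {a} {d} {U}))

lemma3 : (k : ℕ) (F₁ : νHML k) →
    Σ (νHML k) λ F₂ →
    ((L : LTS k) → (Implements L F₁ → Implements L F₂) × (Implements L F₂ → Implements L F₁))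
    × ((x : Fin (νHML.m F₂)) →
    (νHML.decl F₂ x ≡ tt)
    ⊎ Σ (List (Clause k (νHML.m F₂))) λ cs →
    (νHML.decl F₂ x ≡ nfFormula cs)
    × All (λ c → All (λ { (a , x′) → (L : LTS k) →
    ImplementsVar L (νHML.decl F₂) x′ →
    ImplementsVar L (νHML.decl F₂) (boxes c a) })
    (diamonds c)) cs)
lemma3 k ⟪ m , X⁰ , Δ ⟫ =
  ⟪ 2 ^ ∣closure∣ , initial , Δ₂ ⟫ , (λ L → forth , back) ,
  λ y → inj₂ (_ , refl ,
    Allₚ.map⁺ (All.universal diamond⇒box (filter (extends? ⌞ y ⌟) (allSubsets ∣closure∣))))
  where
  open Flattening Δ
  open SubsetConstruction Δᶠ

  Initial : Fin (2 ^ ∣closure∣) → Set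
  Initial y = ∃ λ x → x ∈ X⁰ × ι x ∈ ⌞ y ⌟

  initial? : Decidable Initial
  initial? y = any? (λ x → x ∈? X⁰ ×-dec ι x ∈? ⌞ y ⌟)

  initial : Subset (2 ^ ∣closure∣)
  initial = subset initial?

  forth : ∀ {L} → Implements L ⟪ m , X⁰ , Δ ⟫ → Implements L ⟪ 2 ^ ∣closure∣ , initial , Δ₂ ⟫
  forth (x , x∈X⁰ , s) =
    ⌜ ⁅ ι x ⁆ ⌝ , ∈-subset⁺ initial? (x , x∈X⁰ , ∈⌞⌜⌝⌟⁺ (x∈⁅x⁆ (ι x))) , ⟦Δᶠ⟧⇒⟦Δ₂⟧ (⟦Δ⟧⇒⟦Δᶠ⟧ s)

  back : ∀ {L} → Implements L ⟪ 2 ^ ∣closure∣ , initial , Δ₂ ⟫ → Implements L ⟪ m , X⁰ , Δ ⟫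
  back (y , y∈initial , s) with ∈-subset⁻ initial? y∈initial
  ... | x , x∈X⁰ , ιx∈y = x , x∈X⁰ , ⟦Δᶠ⟧⇒⟦Δ⟧ (⟦Δ₂⟧⇒⟦Δᶠ⟧ s ιx∈y)
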